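{- Let $1\le v\le n$, $E=\{0,1,\dots,n-1\}$, $A\subseteq E$ with $|A|=k$, $A^c=E\setminus A$, and $R=\min(v,n-k,k,n-v)$. Then for every integer $r$, the complement of $B_r(A)$ in $J(n,v)$ equals $B_{R-r-1}(A^c)$.
   Context: $J(n,v)$ denotes the set of all $v$-element subsets of $E$ (vertices of the Johnson graph). For $A\subseteq E$ and an integer $r$, $B_r(A)=\{L\in J(n,v):\min(|L\setminus A|,|A\setminus L|)\le r\}$. -}

module Defs where

open import Data.Nat using (ℕ; _⊓_)
open import Data.Integer using (ℤ; +_; _≤_)
open import Data.Fin.Subset using (Subset; ∣_∣; _─_)
open import Relation.Binary.PropositionalEquality using (_≡_)
open import Data.Product using (_×_)

-- E = {0,…,n-1} is Fin n; subsets of E are 'Subset n'.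
-- L ∈ J(n,v) : L is a v-element subset of E.
InJ : (n v : ℕ) → Subset n → Set
InJ n v L = ∣ L ∣ ≡ v

InBall : (n v : ℕ) → ℤ → Subset n → Subset n → Set
InBall n v r A L = InJ n v L × (+ (∣ L ─ A ∣ ⊓ ∣ A ─ L ∣) ≤ r)

-- Split E into the four Venn regions of L and A, of sizes x = |L \ A|, y = |A \ L|,
-- z = |L ∩ A| and w = |E \ (L ∪ A)|. Then v = x + z, k = y + z, n - k = x + w and
-- n - v = y + w, so R = min(x, y) + min(z, w): the distances of L from A and from
-- Aᶜ always add up to R. Hence min(x, y) > r exactly when min(z, w) ≤ R - r - 1.
module Submission where

open import Defs
open import Data.Nat using (ℕ; _⊓_; _∸_; _≤_; _+_; suc)
open import Data.Nat.Properties using (+-suc; +-comm; +-distribˡ-⊓; +-distribʳ-⊓; ⊓-assoc)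
open import Data.Integer using (ℤ; +_; _-_; 1ℤ; 0ℤ)
import Data.Integer as ℤ
open import Data.Integer.Properties
  using (≰⇒>; <⇒≱; i<j⇒suc[i]≤j; suc[i]≤j⇒i<j; i≤j⇒0≤j-i; 0≤i-j⇒j≤i)
open import Data.Integer.Tactic.RingSolver using (solve-∀)
open import Data.Fin.Subset using (Subset; ∣_∣; ∁; _─_; inside; outside)
open import Data.Fin.Subset.Properties using (∣∁p∣≡n∸∣p∣)
open import Data.Vec using ([]; _∷_)
open import Data.Product using (_×_; _,_)
open import Function.Bundles using (_⇔_; mk⇔; Equivalence)
open import Relation.Binary.PropositionalEquality
  using (_≡_; refl; sym; trans; cong; cong₂; subst; module ≡-Reasoning)
open import Relation.Nullary using (¬_)

private
  variable
    n : ℕ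

δ : Subset n → Subset n → ℕ
δ A L = ∣ L ─ A ∣ ⊓ ∣ A ─ L ∣

∣p∣≡∣p─q∣+∣p─∁q∣ : (p q : Subset n) → ∣ p ∣ ≡ ∣ p ─ q ∣ + ∣ p ─ ∁ q ∣
∣p∣≡∣p─q∣+∣p─∁q∣ []            []            = refl
∣p∣≡∣p─q∣+∣p─∁q∣ (outside ∷ p) (outside ∷ q) = ∣p∣≡∣p─q∣+∣p─∁q∣ p q
∣p∣≡∣p─q∣+∣p─∁q∣ (outside ∷ p) (inside  ∷ q) = ∣p∣≡∣p─q∣+∣p─∁q∣ p q
∣p∣≡∣p─q∣+∣p─∁q∣ (inside  ∷ p) (outside ∷ q) = cong suc (∣p∣≡∣p─q∣+∣p─∁q∣ p q)
∣p∣≡∣p─q∣+∣p─∁q∣ (inside  ∷ p) (inside  ∷ q) =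
  trans (cong suc (∣p∣≡∣p─q∣+∣p─∁q∣ p q)) (sym (+-suc ∣ p ─ q ∣ ∣ p ─ ∁ q ∣))

p─∁q≡q─∁p : (p q : Subset n) → p ─ ∁ q ≡ q ─ ∁ p
p─∁q≡q─∁p []            []            = refl
p─∁q≡q─∁p (outside ∷ p) (outside ∷ q) = cong (outside ∷_) (p─∁q≡q─∁p p q)
p─∁q≡q─∁p (outside ∷ p) (inside  ∷ q) = cong (outside ∷_) (p─∁q≡q─∁p p q)
p─∁q≡q─∁p (inside  ∷ p) (outside ∷ q) = cong (outside ∷_) (p─∁q≡q─∁p p q)
p─∁q≡q─∁p (inside  ∷ p) (inside  ∷ q) = cong (inside  ∷_) (p─∁q≡q─∁p p q)

∁p─q≡∁q─p : (p q : Subset n) → ∁ p ─ q ≡ ∁ q ─ p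
∁p─q≡∁q─p []            []            = refl
∁p─q≡∁q─p (outside ∷ p) (outside ∷ q) = cong (inside  ∷_) (∁p─q≡∁q─p p q)
∁p─q≡∁q─p (outside ∷ p) (inside  ∷ q) = cong (outside ∷_) (∁p─q≡∁q─p p q)
∁p─q≡∁q─p (inside  ∷ p) (outside ∷ q) = cong (outside ∷_) (∁p─q≡∁q─p p q)
∁p─q≡∁q─p (inside  ∷ p) (inside  ∷ q) = cong (outside ∷_) (∁p─q≡∁q─p p q)

∁p─∁q≡q─p : (p q : Subset n) → ∁ p ─ ∁ q ≡ q ─ p
∁p─∁q≡q─p []            []            = refl
∁p─∁q≡q─p (outside ∷ p) (outside ∷ q) = cong (outside ∷_) (∁p─∁q≡q─p p q)
∁p─∁q≡q─p (outside ∷ p) (inside  ∷ q) = cong (inside  ∷_) (∁p─∁q≡q─p p q)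
∁p─∁q≡q─p (inside  ∷ p) (outside ∷ q) = cong (outside ∷_) (∁p─∁q≡q─p p q)
∁p─∁q≡q─p (inside  ∷ p) (inside  ∷ q) = cong (outside ∷_) (∁p─∁q≡q─p p q)

[m⊓n]+[o⊓p]≡[m+o]⊓[m+p]⊓[n+o]⊓[n+p] : ∀ m n o p →
  (m ⊓ n) + (o ⊓ p) ≡ (m + o) ⊓ (m + p) ⊓ (n + o) ⊓ (n + p)
[m⊓n]+[o⊓p]≡[m+o]⊓[m+p]⊓[n+o]⊓[n+p] m n o p = begin
  (m ⊓ n) + (o ⊓ p)                             ≡⟨ +-distribʳ-⊓ (o ⊓ p) m n ⟩
  (m + (o ⊓ p)) ⊓ (n + (o ⊓ p))                 ≡⟨ cong₂ _⊓_ (+-distribˡ-⊓ m o p) (+-distribˡ-⊓ n o p) ⟩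
  ((m + o) ⊓ (m + p)) ⊓ ((n + o) ⊓ (n + p))     ≡⟨ sym (⊓-assoc ((m + o) ⊓ (m + p)) (n + o) (n + p)) ⟩
  (m + o) ⊓ (m + p) ⊓ (n + o) ⊓ (n + p)         ∎
  where open ≡-Reasoning

radius≡δ+δ∁ : (A L : Subset n) →
  ∣ L ∣ ⊓ (n ∸ ∣ A ∣) ⊓ ∣ A ∣ ⊓ (n ∸ ∣ L ∣) ≡ δ A L + δ (∁ A) L
radius≡δ+δ∁ {n} A L = trans (cong₂ _⊓_ (cong₂ _⊓_ (cong₂ _⊓_ ∣L∣≡x+z n∸∣A∣≡x+w) ∣A∣≡y+z) n∸∣L∣≡y+w)
  (sym ([m⊓n]+[o⊓p]≡[m+o]⊓[m+p]⊓[n+o]⊓[n+p] x y z w))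
  where
  open ≡-Reasoning
  x = ∣ L ─ A ∣
  y = ∣ A ─ L ∣
  z = ∣ L ─ ∁ A ∣
  w = ∣ ∁ A ─ L ∣

  ∣L∣≡x+z : ∣ L ∣ ≡ x + z
  ∣L∣≡x+z = ∣p∣≡∣p─q∣+∣p─∁q∣ L A

  ∣A∣≡y+z : ∣ A ∣ ≡ y + z
  ∣A∣≡y+z = trans (∣p∣≡∣p─q∣+∣p─∁q∣ A L) (cong (λ s → y + ∣ s ∣) (p─∁q≡q─∁p A L))

  n∸∣A∣≡x+w : n ∸ ∣ A ∣ ≡ x + w
  n∸∣A∣≡x+w = begin
    n ∸ ∣ A ∣            ≡⟨ sym (∣∁p∣≡n∸∣p∣ A) ⟩
    ∣ ∁ A ∣              ≡⟨ ∣p∣≡∣p─q∣+∣p─∁q∣ (∁ A) L ⟩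
    w + ∣ ∁ A ─ ∁ L ∣    ≡⟨ cong (λ s → w + ∣ s ∣) (∁p─∁q≡q─p A L) ⟩
    w + x                ≡⟨ +-comm w x ⟩
    x + w                ∎

  n∸∣L∣≡y+w : n ∸ ∣ L ∣ ≡ y + w
  n∸∣L∣≡y+w = begin
    n ∸ ∣ L ∣                  ≡⟨ sym (∣∁p∣≡n∸∣p∣ L) ⟩
    ∣ ∁ L ∣                    ≡⟨ ∣p∣≡∣p─q∣+∣p─∁q∣ (∁ L) A ⟩
    ∣ ∁ L ─ A ∣ + ∣ ∁ L ─ ∁ A ∣ ≡⟨ cong₂ (λ s t → ∣ s ∣ + ∣ t ∣) (∁p─q≡∁q─p L A) (∁p─∁q≡q─p L A) ⟩
    w + y                      ≡⟨ +-comm w y ⟩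
    y + w                      ∎

≰⇔≤-complementary : ∀ {R a b} (r : ℤ) → R ≡ a + b → (¬ (+ a ℤ.≤ r)) ⇔ (+ b ℤ.≤ + R - r - 1ℤ)
≰⇔≤-complementary {a = a} {b} r refl = mk⇔
  (λ a≰r → 0≤i-j⇒j≤i (subst (0ℤ ℤ.≤_) slack (i≤j⇒0≤j-i (i<j⇒suc[i]≤j (≰⇒> a≰r)))))
  (λ b≤ → <⇒≱ (suc[i]≤j⇒i<j (0≤i-j⇒j≤i (subst (0ℤ ℤ.≤_) (sym slack) (i≤j⇒0≤j-i b≤)))))
  where
  -- r < a and b ≤ R - r - 1 both say that this common slack is nonnegative.
  slack : + a - (1ℤ ℤ.+ r) ≡ (+ (a + b) - r - 1ℤ) - + b
  slack = identity (+ a) (+ b) r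
    where
    identity : ∀ (i j s : ℤ) → i - (1ℤ ℤ.+ s) ≡ ((i ℤ.+ j) - s - 1ℤ) - j
    identity = solve-∀

lemma11 : (n v k : ℕ) → 1 ≤ v → v ≤ n → (A : Subset n) → ∣ A ∣ ≡ k → (r : ℤ) →
    (L : Subset n) →
      (InJ n v L × ¬ InBall n v r A L)
        ⇔ InBall n v ((+ (v ⊓ (n ∸ k) ⊓ k ⊓ (n ∸ v)) - r) - 1ℤ) (∁ A) L
lemma11 n v k _ _ A refl r L = mk⇔
  (λ { (refl , L∉Bᵣ) → refl , to   (≰⇔≤-complementary r (radius≡δ+δ∁ A L)) (λ δ≤r → L∉Bᵣ (refl , δ≤r)) })
  (λ { (refl , L∈B∁) → refl , λ (_ , δ≤r) → from (≰⇔≤-complementary r (radius≡δ+δ∁ A L)) L∈B∁ δ≤r })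
  where open Equivalence
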